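{- Let $L\ge 1$ be an integer and let $G$ be the semi-infinite cylinder graph with vertex set $\{(x,y): x\in\{1,\dots,L\},\ y\in\mathbb{Z}_{\ge 0}\}$, where horizontal coordinates are taken modulo $L$ (so $(1,y)$ and $(L,y)$ are neighbours). Each vertex $(x,y)$ with $y\ge 1$ has four outgoing directed edges, to its neighbours in the directions N $=(x,y+1)$, E $=(x+1,y)$, S $=(x,y-1)$, W $=(x-1,y)$, with fixed cyclic order N, E, S, W. Each boundary vertex $(x,0)$ has three outgoing edges, to W $=(x-1,0)$, N $=(x,1)$, E $=(x+1,0)$, with fixed cyclic order W, N, E. Add an extra vertex $S$ with $L$ outgoing edges directed to $(\pi(1),0),(\pi(2),0),\dots,(\pi(L),0)$, in this cyclic order, for an arbitrary permutation $\pi$ of $\{1,\dots,L\}$. Every vertex $v\in G\cup\{S\}$ carries a rotor $\rho(v)$ pointing along one of its outgoing edges; the initial rotor configuration $\rho_0$ is arbitrary. Rotor-router aggregation: $A(0)=\emptyset$. Given $A(N)\subset G$, a single chip is placed at $S$ and performs the rotor-router walk: at each step, the rotor at the chip's current vertex $w$ is advanced to the next outgoing edge of $w$ in its cyclic order, and the chip moves along this new rotor direction. The walk stops at the first vertex $v^*\in G$ with $v^*\notin A(N)$, and $A(N+1)=A(N)\cup\{v^*\}$. Rotor configurations are never reset between successive walks. Then for every initial rotor configuration $\rho_0$ and every integer $K\ge 0$, $$A(KL)=\{(x,y): 1\le x\le L,\ 0\le y\le K-1\},$$ i.e. after $KL$ walks the cluster consists exactly of the first $K$ complete rows. Consequently,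 for $N=KL+n$ with $0\le n<L$, $A(N)$ consists of the rows $y=0,\dots,K-1$ together with exactly $n$ vertices of the row $y=K$.
   Context: The rotor-router walk is deterministic given the rotor configuration; the rotor at $S$ is also advanced at each departure from $S$, so that during any $L$ consecutive walks each boundary vertex $(x,0)$ receives exactly one chip directly from $S$. -}

module Defs where

open import Data.Nat as ℕ using (ℕ; zero; suc)
import Data.Nat.Properties as NP
open import Data.Fin as Fin using (Fin; zero; suc; toℕ; fromℕ; inject₁; lower₁)
open import Data.Fin.Permutation using (Permutation′; _⟨$⟩ʳ_)
open import Data.Bool using (Bool; true; false; _∧_; _∨_; if_then_else_)
open import Data.List using (List; []; _∷_; map; allFin)
open import Data.Product using (_×_; _,_; proj₁; proj₂)
open import Relation.Nullary using (yes; no)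
open import Relation.Nullary.Decidable using (⌊_⌋)
open import Relation.Binary.PropositionalEquality using (_≡_; refl; sym)

-- Horizontal coordinate x ∈ Fin L represents the paper's x ∈ {1,…,L}
-- (Fin index i ↔ paper coordinate i+1); arithmetic is modulo L.

next : ∀ {n} → Fin n → Fin n
next {suc m} i with toℕ i ℕ.≟ m
... | yes _ = zero
... | no ne = lower₁ (suc i) (λ eq → ne (sym (NP.suc-injective eq)))

prev : ∀ {n} → Fin n → Fin n
prev {suc m} zero = fromℕ m
prev {suc m} (suc i) = inject₁ i

deg : ℕ → ℕ
deg zero = 3
deg (suc _) = 4

-- For a vertex (x,y) the rotor is an index
-- into the cyclic order of its outgoing edges:
--   y ≥ 1 : 0 = N, 1 = E, 2 = S, 3 = W
--   y = 0 : 0 = W, 1 = N, 2 = E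
--   S     : i ↦ edge to (π i, 0)   (cyclic order π 0, π 1, …, π (L-1))
record Config (L : ℕ) : Set where
  constructor config
  field
    rS : Fin L
    rG : (x : Fin L) (y : ℕ) → Fin (deg y)
open Config public

target : ∀ {L} → Fin L → (y : ℕ) → Fin (deg y) → Fin L × ℕ
target x zero zero = prev x , 0
target x zero (suc zero) = x , 1
target x zero (suc (suc _)) = next x , 0
target x (suc y) zero = x , suc (suc y)
target x (suc y) (suc zero) = next x , suc y
target x (suc y) (suc (suc zero)) = x , y
target x (suc y) (suc (suc (suc _))) = prev x , suc y

advS : ∀ {L} → Config L → Config L
advS ρ = config (next (rS ρ)) (rG ρ)

advG : ∀ {L} → Config L → Fin L → ℕ → Config L
advG {L} ρ x y = config (rS ρ) g
  where
  g : (x' : Fin L) (y' : ℕ) → Fin (deg y')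
  g x' y' with x' Fin.≟ x | y' ℕ.≟ y
  ... | yes refl | yes refl = next (rG ρ x y)
  ... | _ | _ = rG ρ x' y'

Cluster : ℕ → Set
Cluster L = Fin L → ℕ → Bool

emptyC : ∀ {L} → Cluster L
emptyC _ _ = false

insertC : ∀ {L} → Fin L → ℕ → Cluster L → Cluster L
insertC x y A x' y' = (⌊ x' Fin.≟ x ⌋ ∧ ⌊ y' ℕ.≟ y ⌋) ∨ A x' y'

rowsC : ∀ {L} → ℕ → Cluster L
rowsC K x y = ⌊ y ℕ.<? K ⌋

countTrue : List Bool → ℕ
countTrue [] = 0
countTrue (true ∷ bs) = suc (countTrue bs)
countTrue (false ∷ bs) = countTrue bs

rowCount : ∀ {L} → Cluster L → ℕ → ℕ
rowCount {L} A y = countTrue (map (λ x → A x y) (allFin L))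

-- WalkFrom A ρ x y ρ' x* y* : a chip that has just arrived at (x,y) ∈ G,
-- with current rotor configuration ρ, performs the rotor-router walk and
-- stops at (x*,y*) ∉ A, the final configuration being ρ'.
data WalkFrom {L : ℕ} (A : Cluster L) :
     Config L → Fin L → ℕ → Config L → Fin L → ℕ → Set where
  stop : ∀ {ρ x y} → A x y ≡ false → WalkFrom A ρ x y ρ x y
  step : ∀ {ρ x y ρ'' x* y*} → A x y ≡ true →
         let ρ' = advG ρ x y
             t  = target x y (rG ρ' x y)
         in WalkFrom A ρ' (proj₁ t) (proj₂ t) ρ'' x* y* →
            WalkFrom A ρ x y ρ'' x* y*

data WalkS {L : ℕ} (π : Permutation′ L) (A : Cluster L)
     (ρ : Config L) (ρ'' : Config L) (x* : Fin L) (y* : ℕ) : Set where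
  fromS : WalkFrom A (advS ρ) (π ⟨$⟩ʳ rS (advS ρ)) 0 ρ'' x* y* →
          WalkS π A ρ ρ'' x* y*

-- Agg π ρ₀ N A ρ : after N walks started from initial configuration ρ₀
-- the cluster is A(N) = A and the rotor configuration is ρ
-- (rotors are never reset between walks).
data Agg {L : ℕ} (π : Permutation′ L) (ρ₀ : Config L) :
     ℕ → Cluster L → Config L → Set where
  agg0 : Agg π ρ₀ 0 emptyC ρ₀
  aggS : ∀ {N A ρ ρ' x y} → Agg π ρ₀ N A ρ → WalkS π A ρ ρ' x y →
         Agg π ρ₀ (suc N) (insertC x y A) ρ'

-- Group the walks into epochs: epoch K consists of the walks K·L+1, …, K·L+L.
-- During epoch K we compare, at every site, the chips received (the inflow)
-- with the chips passed on (the departures).  A rotor with n positions points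
-- to each position at most once in n consecutive advances (hits-once), so a
-- site making at most deg y · (K ∸ y) departures sends at most K ∸ y chips
-- along each edge, and S sends at most one chip to each boundary site.  A
-- direct count of in-neighbours (inflowCap-below/-row/-above) shows that this
-- departure bound sustains itself below row K, that a site at height ≥ K
-- receives at most one chip, so it absorbs a chip and never passes one on,
-- and that the rows above K receive nothing.  These facts form the invariant
-- EpochState, which every step of a walk preserves; the bounded total of
-- departures makes each walk terminate, and after L walks row K is full.
module Submission where

open import Defs
open import Data.Nat as ℕ using (ℕ; zero; suc; _+_; _*_; _∸_; _<_; _≤_; z≤n; s≤s; _≤ᵇ_)
open import Data.Nat.Properties
open import Data.Nat.DivMod
  using (_%_; _/_; m≡m%n+[m/n]*n; m<n⇒m%n≡m; n%n≡0; %-distribˡ-+; m%n%n≡m%n;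
         +-distrib-/; m*n/n≡m; m<n⇒m/n≡0; m*n%n≡0; [m+kn]%n≡m%n)
open import Data.Nat.ListAction using (sum)
open import Data.Nat.Tactic.RingSolver using (solve-∀)
open import Data.Fin as Fin using (Fin; zero; suc; toℕ; fromℕ; inject₁)
open import Data.Fin.Properties as FinP
  using (toℕ-injective; toℕ<n; toℕ-lower₁; toℕ-fromℕ; toℕ-inject₁; inject₁-lower₁)
open import Data.Fin.Permutation using (Permutation′; _⟨$⟩ʳ_; _⟨$⟩ˡ_; inverseˡ)
open import Data.Bool using (Bool; true; false; T; _∧_; if_then_else_)
open import Data.Maybe using (Maybe; just; nothing)
open import Data.List using (List; []; _∷_; map; tabulate; cartesianProduct; allFin; upTo)
open import Data.List.Properties using (map-tabulate; tabulate-cong)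
open import Data.List.Relation.Unary.Any using (here; there)
open import Data.List.Membership.Propositional using (_∈_)
open import Data.List.Membership.Propositional.Properties using (∈-cartesianProduct⁺; ∈-allFin; ∈-upTo⁺)
open import Data.Product using (Σ; _×_; ∃; ∃-syntax; _,_; proj₁; proj₂)
open import Data.Sum using (inj₁; inj₂)
open import Data.Empty using (⊥; ⊥-elim)
open import Function using (case_of_)
open import Relation.Nullary using (Dec; yes; no; ¬_)
open import Relation.Nullary.Decidable using (⌊_⌋)
open import Relation.Binary.Definitions using (tri<; tri≈; tri>)
open import Relation.Binary.PropositionalEquality

prev-next : ∀ {n} (x : Fin n) → prev (next x) ≡ x
prev-next {suc m} x with toℕ x ℕ.≟ m
... | yes x≡m = toℕ-injective (trans (toℕ-fromℕ m) (sym x≡m))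
prev-next {suc zero} zero | no x≢m = ⊥-elim (x≢m refl)
prev-next {suc (suc m)} x | no x≢m = inject₁-lower₁ x _

next-prev : ∀ {n} (x : Fin n) → next (prev x) ≡ x
next-prev {suc m} zero with toℕ (fromℕ m) ℕ.≟ m
... | yes _ = refl
... | no ≢m = ⊥-elim (≢m (toℕ-fromℕ m))
next-prev {suc m} (suc i) with toℕ (inject₁ i) ℕ.≟ m
... | yes i≡m = ⊥-elim (<-irrefl (trans (sym (toℕ-inject₁ i)) i≡m) (toℕ<n i))
... | no i≢m = toℕ-injective (trans (toℕ-lower₁ (suc (inject₁ i)) (λ eq → i≢m (sym (suc-injective eq)))) (cong suc (toℕ-inject₁ i)))

advance : ∀ {n} → ℕ → Fin n → Fin n
advance zero    r = r
advance (suc k) r = next (advance k r)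

advance-+ : ∀ {n} a b (r : Fin n) → advance a (advance b r) ≡ advance (a + b) r
advance-+ zero    b r = refl
advance-+ (suc a) b r = cong next (advance-+ a b r)

toℕ-next : ∀ {m} (i : Fin (suc m)) → toℕ (next i) ≡ suc (toℕ i) % suc m
toℕ-next {m} i with toℕ i ℕ.≟ m
... | yes i≡m = trans (sym (n%n≡0 (suc m))) (cong (λ k → suc k % suc m) (sym i≡m))
... | no i≢m = trans (toℕ-lower₁ (suc i) (λ eq → i≢m (sym (suc-injective eq))))
                 (sym (m<n⇒m%n≡m (s≤s (≤∧≢⇒< (ℕ.≤-pred (toℕ<n i)) i≢m))))

toℕ-advance : ∀ {m} k (r : Fin (suc m)) → toℕ (advance k r) ≡ (toℕ r + k) % suc m
toℕ-advance {m} zero r =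
  trans (sym (m<n⇒m%n≡m (toℕ<n r))) (cong (_% suc m) (sym (+-identityʳ (toℕ r))))
toℕ-advance {m} (suc k) r = begin
  toℕ (next (advance k r))                     ≡⟨ toℕ-next (advance k r) ⟩
  (1 + toℕ (advance k r)) % suc m             ≡⟨ cong (λ t → (1 + t) % suc m) (toℕ-advance k r) ⟩
  (1 + (toℕ r + k) % suc m) % suc m           ≡⟨ %-distribˡ-+ 1 ((toℕ r + k) % suc m) (suc m) ⟩
  (1 % suc m + (toℕ r + k) % suc m % suc m) % suc m
                                              ≡⟨ cong (λ t → (1 % suc m + t) % suc m) (m%n%n≡m%n (toℕ r + k) (suc m)) ⟩
  (1 % suc m + (toℕ r + k) % suc m) % suc m   ≡⟨ %-distribˡ-+ 1 (toℕ r + k) (suc m) ⟨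
  (1 + (toℕ r + k)) % suc m                   ≡⟨ cong (_% suc m) (+-suc (toℕ r) k) ⟨
  (toℕ r + suc k) % suc m                     ∎
  where open ≡-Reasoning

advance-aperiodic : ∀ {n} k (r : Fin n) → 0 < k → k < n → advance k r ≢ r
advance-aperiodic {suc m} k r 0<k k<n returns = not-a-multiple q k≡q*n
  where
  a = toℕ r
  q = (a + k) / suc m
  remainder : (a + k) % suc m ≡ a
  remainder = trans (sym (toℕ-advance k r)) (cong toℕ returns)
  k≡q*n : k ≡ q * suc m
  k≡q*n = +-cancelˡ-≡ a k (q * suc m)
            (trans (m≡m%n+[m/n]*n (a + k) (suc m)) (cong (_+ q * suc m) remainder))
  not-a-multiple : ∀ p → k ≡ p * suc m → ⊥
  not-a-multiple zero    k≡0   = <-irrefl (sym k≡0) 0<k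
  not-a-multiple (suc p) k≡n+p = <⇒≱ k<n (≤-trans (m≤m+n (suc m) (p * suc m)) (≤-reflexive (sym k≡n+p)))

indicator : ∀ {n} → Fin n → Fin n → ℕ
indicator a e with a Fin.≟ e
... | yes _ = 1
... | no  _ = 0

indicator-self : ∀ {n} (a : Fin n) → indicator a a ≡ 1
indicator-self a with a Fin.≟ a
... | yes _  = refl
... | no a≢a = ⊥-elim (a≢a refl)

indicator-≢ : ∀ {n} {a e : Fin n} → a ≢ e → indicator a e ≡ 0
indicator-≢ {a = a} {e} a≢e with a Fin.≟ e
... | yes a≡e = ⊥-elim (a≢e a≡e)
... | no  _   = refl

-- hits k r e: how often a rotor started at r points to e during its next k
-- advances, i.e. how many chips it sends along edge e in k departures.
hits : ∀ {n} → ℕ → Fin n → Fin n → ℕ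
hits zero    r e = 0
hits (suc k) r e = hits k r e + indicator (advance (suc k) r) e

hits-mono : ∀ {n} {k k'} (r e : Fin n) → k ≤ k' → hits k r e ≤ hits k' r e
hits-mono {k' = zero}   r e z≤n = ≤-refl
hits-mono {k' = suc k'} r e k≤1+k' with m≤n⇒m<n∨m≡n k≤1+k'
... | inj₂ refl      = ≤-refl
... | inj₁ (s≤s k≤k') = ≤-trans (hits-mono r e k≤k') (m≤m+n _ _)

hits-+ : ∀ {n} a b (r e : Fin n) → hits (a + b) r e ≡ hits b r e + hits a (advance b r) e
hits-+ zero    b r e = sym (+-identityʳ _)
hits-+ (suc a) b r e = begin
  hits (a + b) r e + indicator (next (advance (a + b) r)) e
    ≡⟨ cong₂ _+_ (hits-+ a b r e) (cong (λ t → indicator (next t) e) (sym (advance-+ a b r))) ⟩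
  hits b r e + hits a (advance b r) e + indicator (next (advance a (advance b r))) e
    ≡⟨ +-assoc (hits b r e) _ _ ⟩
  hits b r e + (hits a (advance b r) e + indicator (next (advance a (advance b r))) e)
    ∎
  where open ≡-Reasoning

hits-none : ∀ {n} k (r e : Fin n) → (∀ i → 0 < i → i ≤ k → advance i r ≢ e) → hits k r e ≡ 0
hits-none zero    r e missed = refl
hits-none (suc k) r e missed =
  cong₂ _+_ (hits-none k r e (λ i 0<i i≤k → missed i 0<i (m≤n⇒m≤1+n i≤k)))
            (indicator-≢ (missed (suc k) (s≤s z≤n) ≤-refl))

hits-once : ∀ {n} k (r e : Fin n) → k ≤ n → hits k r e ≤ 1
hits-once zero    r e _     = z≤n
hits-once (suc k) r e 1+k≤n = byLastHit (advance (suc k) r Fin.≟ e)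
  where
  byLastHit : Dec (advance (suc k) r ≡ e) → hits (suc k) r e ≤ 1
  byLastHit (no miss) =
    ≤-trans (≤-reflexive (trans (cong (hits k r e +_) (indicator-≢ miss)) (+-identityʳ _)))
            (hits-once k r e (≤-trans (n≤1+n k) 1+k≤n))
  byLastHit (yes refl) = ≤-reflexive (cong₂ _+_ (hits-none k r _ earlier) (indicator-self _))
    where
    -- an earlier hit at step i would make the rotor return after suc k ∸ i < n steps
    earlier : ∀ i → 0 < i → i ≤ k → advance i r ≢ advance (suc k) r
    earlier i 0<i i≤k same = advance-aperiodic (suc k ∸ i) (advance i r)
      (m<n⇒0<n∸m (s≤s i≤k))
      (≤-trans (∸-monoʳ-< 0<i (m≤n⇒m≤1+n i≤k)) 1+k≤n)
      (trans (advance-+ (suc k ∸ i) i r)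
             (trans (cong (λ t → advance t r) (m∸n+n≡m (m≤n⇒m≤1+n i≤k))) (sym same)))

hits-rounds : ∀ {n} m k (r e : Fin n) → k ≤ n * m → hits k r e ≤ m
hits-rounds {n} zero    k r e k≤0 = ≤-trans (hits-mono r e (≤-trans k≤0 (≤-reflexive (*-zeroʳ n)))) z≤n
hits-rounds {n} (suc m) k r e k≤n+nm = begin
  hits k r e                                         ≤⟨ hits-mono r e (≤-trans k≤n+nm (≤-reflexive (*-suc n m))) ⟩
  hits (n + n * m) r e                               ≡⟨ hits-+ n (n * m) r e ⟩
  hits (n * m) r e + hits n (advance (n * m) r) e    ≤⟨ +-mono-≤ (hits-rounds m (n * m) r e ≤-refl) (hits-once n _ e ≤-refl) ⟩
  m + 1                                              ≡⟨ +-comm m 1 ⟩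
  suc m                                              ∎
  where open ≤-Reasoning

hits-step : ∀ {n} k (r : Fin n) → hits k r (advance (suc k) r) < hits (suc k) r (advance (suc k) r)
hits-step k r = ≤-reflexive (trans (+-comm 1 _) (cong (hits k r a +_) (sym (indicator-self a))))
  where a = advance (suc k) r

trueCount : ∀ {n} → (Fin n → Bool) → ℕ
trueCount f = countTrue (tabulate f)

rowCount-trueCount : ∀ {L} (A : Cluster L) y → rowCount A y ≡ trueCount (λ x → A x y)
rowCount-trueCount A y = cong countTrue (map-tabulate (λ x → x) (λ x → A x y))

trueCount-cong : ∀ {n} (f g : Fin n → Bool) → (∀ i → f i ≡ g i) → trueCount f ≡ trueCount g
trueCount-cong f g f≗g = cong countTrue (tabulate-cong f≗g)

trueCount-allFalse : ∀ {n} (f : Fin n → Bool) → (∀ i → f i ≡ false) → trueCount f ≡ 0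
trueCount-allFalse {zero}  f allFalse = refl
trueCount-allFalse {suc n} f allFalse with f zero | allFalse zero
... | false | refl = trueCount-allFalse (λ i → f (suc i)) (λ i → allFalse (suc i))

trueCount-≤ : ∀ {n} (f : Fin n → Bool) → trueCount f ≤ n
trueCount-≤ {zero}  f = z≤n
trueCount-≤ {suc n} f with f zero
... | true  = s≤s (trueCount-≤ (λ i → f (suc i)))
... | false = m≤n⇒m≤1+n (trueCount-≤ (λ i → f (suc i)))

trueCount-full : ∀ {n} (f : Fin n → Bool) → trueCount f ≡ n → ∀ i → f i ≡ true
trueCount-full {suc n} f full i with f zero in f0
trueCount-full {suc n} f full zero    | true  = f0
trueCount-full {suc n} f full (suc i) | true  = trueCount-full (λ i → f (suc i)) (suc-injective full) i
trueCount-full {suc n} f full i       | false = ⊥-elim (<-irrefl full (s≤s (trueCount-≤ (λ i → f (suc i)))))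

trueCount-empty : ∀ {n} (f : Fin n → Bool) → trueCount f ≡ 0 → ∀ i → f i ≡ false
trueCount-empty {suc n} f empty i with f zero in f0
trueCount-empty {suc n} f empty zero    | false = f0
trueCount-empty {suc n} f empty (suc i) | false = trueCount-empty (λ i → f (suc i)) empty i

trueCount-insert : ∀ {n} (f g : Fin n → Bool) x → f x ≡ false → g x ≡ true →
                   (∀ i → i ≢ x → g i ≡ f i) → trueCount g ≡ suc (trueCount f)
trueCount-insert {suc n} f g zero fx gx others with f zero | g zero
... | false | true = cong suc (trueCount-cong _ _ (λ i → others (suc i) (λ ())))
trueCount-insert {suc n} f g (suc x) fx gx others
  with f zero | g zero | others zero (λ ())
     | trueCount-insert (λ i → f (suc i)) (λ i → g (suc i)) x fx gx
         (λ i i≢x → others (suc i) (λ eq → i≢x (FinP.suc-injective eq)))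
... | true  | true  | refl | rest = cong suc rest
... | false | false | refl | rest = rest

sum-map-mono : ∀ {A : Set} (xs : List A) {f g : A → ℕ} → (∀ a → f a ≤ g a) →
               sum (map f xs) ≤ sum (map g xs)
sum-map-mono []       f≤g = z≤n
sum-map-mono (a ∷ xs) f≤g = +-mono-≤ (f≤g a) (sum-map-mono xs f≤g)

sum-map-strict : ∀ {A : Set} {xs : List A} {f g : A → ℕ} {a} → (∀ b → f b ≤ g b) →
                 a ∈ xs → f a < g a → sum (map f xs) < sum (map g xs)
sum-map-strict {xs = _ ∷ xs} f≤g (here refl) fa<ga = +-mono-<-≤ fa<ga (sum-map-mono xs f≤g)
sum-map-strict {xs = b ∷ _}  f≤g (there a∈xs) fa<ga = +-mono-≤-< (f≤g b) (sum-map-strict f≤g a∈xs fa<ga)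

insert-keeps : ∀ {L} x y (A : Cluster L) x' y' → A x' y' ≡ true → insertC x y A x' y' ≡ true
insert-keeps x y A x' y' A∋ with ⌊ x' Fin.≟ x ⌋ ∧ ⌊ y' ℕ.≟ y ⌋
... | true  = refl
... | false = A∋

insert-otherRow : ∀ {L} x y (A : Cluster L) x' y' → y' ≢ y → insertC x y A x' y' ≡ A x' y'
insert-otherRow x y A x' y' y'≢y with y' ℕ.≟ y
... | yes y'≡y = ⊥-elim (y'≢y y'≡y)
... | no _ with ⌊ x' Fin.≟ x ⌋
...   | true  = refl
...   | false = refl

insert-rowCount : ∀ {L} x y (A : Cluster L) → A x y ≡ false →
                  rowCount (insertC x y A) y ≡ suc (rowCount A y)
insert-rowCount x y A new = begin
  rowCount (insertC x y A) y                   ≡⟨ rowCount-trueCount (insertC x y A) y ⟩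
  trueCount (λ x' → insertC x y A x' y)        ≡⟨ trueCount-insert _ _ x new inserted others ⟩
  suc (trueCount (λ x' → A x' y))              ≡⟨ cong suc (rowCount-trueCount A y) ⟨
  suc (rowCount A y)                           ∎
  where
  open ≡-Reasoning
  inserted : insertC x y A x y ≡ true
  inserted with x Fin.≟ x | y ℕ.≟ y
  ... | yes _ | yes _  = refl
  ... | no x≢x | _     = ⊥-elim (x≢x refl)
  ... | yes _ | no y≢y = ⊥-elim (y≢y refl)
  others : ∀ x' → x' ≢ x → insertC x y A x' y ≡ A x' y
  others x' x'≢x with x' Fin.≟ x
  ... | yes x'≡x = ⊥-elim (x'≢x x'≡x)
  ... | no _     = refl

rows-exact : ∀ {L} (A : Cluster L) K → (∀ x y → y < K → A x y ≡ true) →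
             (∀ x y → K < y → A x y ≡ false) → rowCount A K ≡ 0 → ∀ x y → A x y ≡ rowsC K x y
rows-exact A K below above rowK-empty x y with y ℕ.<? K
... | yes y<K = below x y y<K
... | no  y≮K with m≤n⇒m<n∨m≡n (≮⇒≥ y≮K)
...   | inj₁ K<y  = above x y K<y
...   | inj₂ refl = trueCount-empty (λ x → A x K) (trans (sym (rowCount-trueCount A K)) rowK-empty) x

-- capacity K y: the bound on the departures from a site at height y during
-- epoch K that the invariant maintains; it lets each of the deg y out-edges
-- carry K ∸ y chips.
capacity : ℕ → ℕ → ℕ
capacity K y = deg y * (K ∸ y)

-- inflowCap K y: the most chips a site at height y receives during epoch K
-- if every site respects its capacity: S sends one chip to each boundary
-- site, and each neighbour at height y' at most K ∸ y' chips along each edge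
-- (summing over the in-neighbours S, (x,1), (x-1,0), (x+1,0), resp.
-- (x,y), (x,y+2), (x-1,y+1), (x+1,y+1)).
inflowCap : ℕ → ℕ → ℕ
inflowCap K zero    = 1 + (K ∸ 1) + K + K
inflowCap K (suc y) = (K ∸ y) + (K ∸ suc (suc y)) + (K ∸ suc y) + (K ∸ suc y)

inflowCap-below : ∀ K y → y < K → inflowCap K y ≤ capacity K y
inflowCap-below (suc m)       zero          _ = ≤-reflexive (boundary m)
  where
  boundary : ∀ m → 1 + m + suc m + suc m ≡ 3 * suc m
  boundary = solve-∀
inflowCap-below (suc (suc m)) (suc zero)    _ = ≤-reflexive (firstRow m)
  where
  firstRow : ∀ m → suc (suc m) + m + suc m + suc m ≡ 4 * suc m
  firstRow = solve-∀
inflowCap-below (suc K)       (suc (suc y)) (s≤s y<K) = inflowCap-below K (suc y) y<K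

inflowCap-above : ∀ K y → K < y → inflowCap K y ≡ 0
inflowCap-above zero    (suc zero)    _ = refl
inflowCap-above zero    (suc (suc y)) _ = refl
inflowCap-above (suc K) (suc (suc y)) (s≤s K<y) = inflowCap-above K (suc y) K<y

inflowCap-row : ∀ K y → K ≤ y → inflowCap K y ≤ 1
inflowCap-row zero          zero          _ = ≤-refl
inflowCap-row zero          (suc zero)    _ = z≤n
inflowCap-row zero          (suc (suc y)) _ = z≤n
inflowCap-row (suc zero)    (suc zero)    _ = ≤-refl
inflowCap-row (suc zero)    (suc (suc y)) _ = ≤-trans (≤-reflexive (inflowCap-above 1 (suc (suc y)) (s≤s (s≤s z≤n)))) z≤n
inflowCap-row (suc (suc K)) (suc (suc y)) (s≤s K≤y) = inflowCap-row (suc K) (suc y) K≤y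

divMod-unique : ∀ {L K K' n n'} → n < L → n' < L → K * L + n ≡ K' * L + n' → K ≡ K' × n ≡ n'
divMod-unique {suc l} {K} {K'} n<L n'<L eq =
  trans (sym (quotient K n<L)) (trans (cong (_/ L) eq) (quotient K' n'<L)) ,
  trans (sym (remainder K n<L)) (trans (cong (_% L) eq) (remainder K' n'<L))
  where
  L = suc l
  quotient : ∀ K {n} → n < L → (K * L + n) / L ≡ K
  quotient K {n} n<L = begin
    (K * L + n) / L    ≡⟨ +-distrib-/ (K * L) n (subst (_< L) (sym (cong₂ _+_ (m*n%n≡0 K L) (m<n⇒m%n≡m n<L))) n<L) ⟩
    K * L / L + n / L  ≡⟨ cong₂ _+_ (m*n/n≡m K L) (m<n⇒m/n≡0 n<L) ⟩
    K + 0              ≡⟨ +-identityʳ K ⟩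
    K                  ∎
    where open ≡-Reasoning
  remainder : ∀ K {n} → n < L → (K * L + n) % L ≡ n
  remainder K {n} n<L = trans (cong (_% L) (+-comm (K * L) n)) (trans ([m+kn]%n≡m%n n K L) (m<n⇒m%n≡m n<L))

module Aggregation {L : ℕ} (π : Permutation′ L) where

  -- d x y: the number of departures from (x,y) so far in the current epoch.
  Departures : Set
  Departures = Fin L → ℕ → ℕ

  data Edge : Set where
    outOfS : Fin L → Edge
    outOf  : (x : Fin L) (y : ℕ) → Fin (deg y) → Edge

  north : (y : ℕ) → Fin (deg y)
  north zero    = suc zero
  north (suc _) = zero

  -- The edges entering (x,y): from S and from the north, west and east
  -- neighbours at the boundary; from the south, north, west and east
  -- neighbours in the bulk.  (Edge indices: W = 0, N = 1, E = 2 at the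
  -- boundary; N = 0, E = 1, S = 2, W = 3 in the bulk.)
  incoming : Fin L → ℕ → List Edge
  incoming x zero =
    outOfS (π ⟨$⟩ˡ x) ∷ outOf x 1 (suc (suc zero)) ∷
    outOf (prev x) 0 (suc (suc zero)) ∷ outOf (next x) 0 zero ∷ []
  incoming x (suc y) =
    outOf x y (north y) ∷ outOf x (suc (suc y)) (suc (suc zero)) ∷
    outOf (prev x) (suc y) (suc zero) ∷ outOf (next x) (suc y) (suc (suc (suc zero))) ∷ []

  incoming-target : ∀ x y e → outOf x y e ∈ incoming (proj₁ (target x y e)) (proj₂ (target x y e))
  incoming-target x zero zero = there (there (there (here (cong (λ z → outOf z 0 zero) (sym (next-prev x))))))
  incoming-target x zero (suc zero) = here refl
  incoming-target x zero (suc (suc zero)) = there (there (here (cong (λ z → outOf z 0 _) (sym (prev-next x)))))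
  incoming-target x (suc y) zero = here refl
  incoming-target x (suc y) (suc zero) = there (there (here (cong (λ z → outOf z (suc y) _) (sym (prev-next x)))))
  incoming-target x (suc zero) (suc (suc zero)) = there (here refl)
  incoming-target x (suc (suc y)) (suc (suc zero)) = there (here refl)
  incoming-target x (suc y) (suc (suc (suc zero))) =
    there (there (there (here (cong (λ z → outOf z (suc y) _) (sym (next-prev x))))))

  -- The chips sent along an edge during an epoch that started in rotor
  -- configuration ρb, after j walks from S and d x y departures from each (x,y).
  sent : Config L → Departures → ℕ → Edge → ℕ
  sent ρb d j (outOfS i)    = hits j (rS ρb) i
  sent ρb d j (outOf x y e) = hits (d x y) (rG ρb x y) e

  inflow : Config L → Departures → ℕ → Fin L → ℕ → ℕ
  inflow ρb d j x y = sum (map (sent ρb d j) (incoming x y))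

  sent-mono : ∀ ρb {d d' : Departures} {j j'} → (∀ x y → d x y ≤ d' x y) → j ≤ j' →
              ∀ ε → sent ρb d j ε ≤ sent ρb d' j' ε
  sent-mono ρb d≤d' j≤j' (outOfS i)    = hits-mono _ i j≤j'
  sent-mono ρb d≤d' j≤j' (outOf x y e) = hits-mono _ e (d≤d' x y)

  inflow-mono : ∀ ρb {d d' : Departures} {j j'} → (∀ x y → d x y ≤ d' x y) → j ≤ j' →
                ∀ x y → inflow ρb d j x y ≤ inflow ρb d' j' x y
  inflow-mono ρb d≤d' j≤j' x y = sum-map-mono (incoming x y) (sent-mono ρb d≤d' j≤j')

  edgeCap : ℕ → Edge → ℕ
  edgeCap K (outOfS _)    = 1
  edgeCap K (outOf _ y _) = K ∸ y

  sent-capped : ∀ K ρb {d j} → (∀ x y → d x y ≤ capacity K y) → j ≤ L →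
                ∀ ε → sent ρb d j ε ≤ edgeCap K ε
  sent-capped K ρb d≤cap j≤L (outOfS i)    = hits-once _ _ i j≤L
  sent-capped K ρb d≤cap j≤L (outOf x y e) = hits-rounds (K ∸ y) _ _ e (d≤cap x y)

  inflow-capped : ∀ K ρb {d j} → (∀ x y → d x y ≤ capacity K y) → j ≤ L →
                  ∀ x y → inflow ρb d j x y ≤ inflowCap K y
  inflow-capped K ρb d≤cap j≤L x y =
    ≤-trans (sum-map-mono (incoming x y) (sent-capped K ρb d≤cap j≤L)) (≤-reflexive (incomingCap y))
    where
    four : ∀ a b c e → a + (b + (c + (e + 0))) ≡ a + b + c + e
    four a b c e = trans (cong (λ t → a + (b + (c + t))) (+-identityʳ e))
                         (trans (sym (+-assoc a b (c + e))) (sym (+-assoc (a + b) c e)))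
    incomingCap : ∀ y → sum (map (edgeCap K) (incoming x y)) ≡ inflowCap K y
    incomingCap zero    = four 1 (K ∸ 1) K K
    incomingCap (suc y) = four (K ∸ y) (K ∸ suc (suc y)) (K ∸ suc y) (K ∸ suc y)

  marker : Fin L → ℕ → Fin L → ℕ → ℕ
  marker x y x' y' with x' Fin.≟ x | y' ℕ.≟ y
  ... | yes refl | yes refl = 1
  ... | _        | _        = 0

  marker-self : ∀ x y → marker x y x y ≡ 1
  marker-self x y with x Fin.≟ x | y ℕ.≟ y
  ... | yes refl | yes refl = refl
  ... | no x≢x   | _        = ⊥-elim (x≢x refl)
  ... | yes refl | no y≢y   = ⊥-elim (y≢y refl)

  marker-absorb : ∀ (F G : Fin L → ℕ → ℕ) x y → (∀ x' y' → F x' y' ≤ G x' y') →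
                  F x y < G x y → ∀ x' y' → marker x y x' y' + F x' y' ≤ G x' y'
  marker-absorb F G x y F≤G Fxy<Gxy x' y' with x' Fin.≟ x | y' ℕ.≟ y
  ... | yes refl | yes refl = Fxy<Gxy
  ... | yes refl | no _     = F≤G x' y'
  ... | no _     | _        = F≤G x' y'

  bump : Departures → Fin L → ℕ → Departures
  bump d x y x' y' = marker x y x' y' + d x' y'

  bump-self : ∀ d x y → bump d x y x y ≡ suc (d x y)
  bump-self d x y = cong (_+ d x y) (marker-self x y)

  bump-≥ : ∀ d x y x' y' → d x' y' ≤ bump d x y x' y'
  bump-≥ d x y x' y' = m≤n+m (d x' y') (marker x y x' y')

  advG-bump : ∀ ρ ρb d x y → (∀ x' y' → rG ρ x' y' ≡ advance (d x' y') (rG ρb x' y')) →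
              ∀ x' y' → rG (advG ρ x y) x' y' ≡ advance (bump d x y x' y') (rG ρb x' y')
  advG-bump ρ ρb d x y rotors x' y' with x' Fin.≟ x | y' ℕ.≟ y
  ... | yes refl | yes refl = cong next (rotors x y)
  ... | yes refl | no _     = rotors x' y'
  ... | no _     | _        = rotors x' y'

  departure-feeds : ∀ ρb d j x y →
    let e = advance (suc (d x y)) (rG ρb x y)
        t = target x y e
    in inflow ρb d j (proj₁ t) (proj₂ t) < inflow ρb (bump d x y) j (proj₁ t) (proj₂ t)
  departure-feeds ρb d j x y =
    sum-map-strict (sent-mono ρb (bump-≥ d x y) ≤-refl) (incoming-target x y e)
      (≤-trans (hits-step (d x y) r) (≤-reflexive (cong (λ k → hits k r e) (sym (bump-self d x y)))))
    where
    r = rG ρb x y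
    e = advance (suc (d x y)) r

  launch-feeds : ∀ ρb d j →
    let x = π ⟨$⟩ʳ advance (suc j) (rS ρb)
    in inflow ρb d j x 0 < inflow ρb d (suc j) x 0
  launch-feeds ρb d j =
    sum-map-strict {xs = incoming (π ⟨$⟩ʳ i) 0} {f = sent ρb d j} {g = sent ρb d (suc j)}
      (sent-mono ρb (λ _ _ → ≤-refl) (n≤1+n j)) (here refl)
      (subst (λ i' → hits j (rS ρb) i' < hits (suc j) (rS ρb) i') (sym (inverseˡ π)) (hits-step j (rS ρb)))
    where
    i = advance (suc j) (rS ρb)

  Chip : Set
  Chip = Maybe (Fin L × ℕ)

  chipMass : Chip → Fin L → ℕ → ℕ
  chipMass nothing        = λ _ _ → 0
  chipMass (just (x , y)) = marker x y

  inFlight : Chip → ℕ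
  inFlight nothing  = 0
  inFlight (just _) = 1

  -- newSite K A x y = 1 iff (x,y) ∈ A and y ≥ K, i.e. (x,y) was added to the
  -- cluster during epoch K.
  newSite : ℕ → Cluster L → Fin L → ℕ → ℕ
  newSite K A x y = if A x y then (if K ≤ᵇ y then 1 else 0) else 0

  newSite-occupied : ∀ K A x y → A x y ≡ true → K ≤ y → newSite K A x y ≡ 1
  newSite-occupied K A x y occupied K≤y with A x y | K ≤ᵇ y | ≤⇒≤ᵇ K≤y
  ... | true | true | _ = refl

  newSite-old : ∀ K A x y → (A x y ≡ true → y < K) → newSite K A x y ≡ 0
  newSite-old K A x y old with A x y | K ≤ᵇ y in K≤ᵇy
  ... | false | _     = refl
  ... | true  | false = refl
  ... | true  | true  = ⊥-elim (<⇒≱ (old refl) (≤ᵇ⇒≤ K y (subst T (sym K≤ᵇy) _)))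

  newSite-insert : ∀ K x y A x' y' → newSite K (insertC x y A) x' y' ≤ marker x y x' y' + newSite K A x' y'
  newSite-insert K x y A x' y' with x' Fin.≟ x | y' ℕ.≟ y
  ... | yes refl | yes refl with K ≤ᵇ y'
  ...   | true  = s≤s z≤n
  ...   | false = z≤n
  newSite-insert K x y A x' y' | yes refl | no _ = ≤-refl
  newSite-insert K x y A x' y' | no _     | _    = ≤-refl

  -- The state part-way through epoch K, i.e. during the walks K·L+1, …, K·L+L,
  -- in terms of the rotor configuration ρb at the start of the epoch, the
  -- departures d and the number j of walks started in this epoch.  The key
  -- field is conservation: a site holds the walking chip, absorbs a chip, or
  -- passes a chip on at most as often as it receives one.  With the
  -- capacity bound it confines the walks to rows ≤ K, and row K fills up.
  record EpochState (K : ℕ) (ρb : Config L) (A : Cluster L) (ρ : Config L)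
                    (d : Departures) (j : ℕ) (chip : Chip) : Set where
    field
      rotorsG      : ∀ x y → rG ρ x y ≡ advance (d x y) (rG ρb x y)
      rotorS       : rS ρ ≡ advance j (rS ρb)
      withinCap    : ∀ x y → d x y ≤ capacity K y
      walks≤L      : j ≤ L
      rowsBelow    : ∀ x y → y < K → A x y ≡ true
      rowsAbove    : ∀ x y → K < y → A x y ≡ false
      conservation : ∀ x y → chipMass chip x y + newSite K A x y + d x y ≤ inflow ρb d j x y
      rowFill      : rowCount A K + inFlight chip ≡ j
  open EpochState

  inflow-bounded : ∀ {K ρb A ρ d j c} → EpochState K ρb A ρ d j c →
                   ∀ x y → inflow ρb d j x y ≤ inflowCap K y
  inflow-bounded {K} {ρb} s = inflow-capped K ρb (withinCap s) (walks≤L s)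

  chipHere : ∀ {K ρb A ρ d j x y} → EpochState K ρb A ρ d j (just (x , y)) →
             suc (newSite K A x y + d x y) ≤ inflowCap K y
  chipHere {K} {A = A} {d = d} {x = x} {y} s =
    ≤-trans (≤-reflexive (cong (λ m → m + newSite K A x y + d x y) (sym (marker-self x y))))
            (≤-trans (conservation s x y) (inflow-bounded s x y))

  departure-allowed : ∀ {K ρb A ρ d j x y} → EpochState K ρb A ρ d j (just (x , y)) →
                      A x y ≡ true → y < K × suc (d x y) ≤ capacity K y
  departure-allowed {K} {A = A} {d = d} {x = x} {y} s occupied with y <? K
  ... | yes y<K = y<K , ≤-trans (s≤s (m≤n+m (d x y) _)) (≤-trans (chipHere s) (inflowCap-below K y y<K))
  ... | no  y≮K = ⊥-elim (twoChips (≤-trans (chipHere s) (inflowCap-row K y (≮⇒≥ y≮K))))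
    where
    twoChips : ¬ suc (newSite K A x y + d x y) ≤ 1
    twoChips rec rewrite newSite-occupied K A x y occupied (≮⇒≥ y≮K) with rec
    ... | s≤s ()

  stopRow : ∀ {K ρb A ρ d j x y} → EpochState K ρb A ρ d j (just (x , y)) → A x y ≡ false → y ≡ K
  stopRow {K} {x = x} {y} s vacant with <-cmp y K
  ... | tri≈ _ y≡K _ = y≡K
  ... | tri< y<K _ _ = case trans (sym vacant) (rowsBelow s x y y<K) of λ ()
  ... | tri> _ _ K<y = ⊥-elim (<⇒≱ (chipHere s) (≤-trans (≤-reflexive (inflowCap-above K y K<y)) z≤n))

  stepState : ∀ {K ρb A ρ d j x y} → EpochState K ρb A ρ d j (just (x , y)) → A x y ≡ true →
              let ρ' = advG ρ x y in
              EpochState K ρb A ρ' (bump d x y) j (just (target x y (rG ρ' x y)))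
  stepState {K} {ρb} {A} {ρ} {d} {j} {x} {y} s occupied = record
    { rotorsG      = rotors'
    ; rotorS       = rotorS s
    ; withinCap    = marker-absorb d (λ _ y' → capacity K y') x y (withinCap s)
                       (proj₂ (departure-allowed s occupied))
    ; walks≤L      = walks≤L s
    ; rowsBelow    = rowsBelow s
    ; rowsAbove    = rowsAbove s
    ; conservation = conservation'
    ; rowFill      = rowFill s
    }
    where
    rotors' = advG-bump ρ ρb d x y (rotorsG s)
    e = rG (advG ρ x y) x y
    t = target x y e
    e-advanced : advance (suc (d x y)) (rG ρb x y) ≡ e
    e-advanced = sym (trans (rotors' x y) (cong (λ k → advance k (rG ρb x y)) (bump-self d x y)))
    feeds : inflow ρb d j (proj₁ t) (proj₂ t) < inflow ρb (bump d x y) j (proj₁ t) (proj₂ t)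
    feeds = subst (λ e' → let t' = target x y e' in
                          inflow ρb d j (proj₁ t') (proj₂ t') < inflow ρb (bump d x y) j (proj₁ t') (proj₂ t'))
                  e-advanced (departure-feeds ρb d j x y)
    regroup : ∀ a b c e → a + b + (c + e) ≡ a + (c + b + e)
    regroup = solve-∀
    conservation' : ∀ x' y' → marker (proj₁ t) (proj₂ t) x' y' + newSite K A x' y' + bump d x y x' y'
                              ≤ inflow ρb (bump d x y) j x' y'
    conservation' x' y' = begin
      marker (proj₁ t) (proj₂ t) x' y' + newSite K A x' y' + (marker x y x' y' + d x' y')
        ≡⟨ regroup (marker (proj₁ t) (proj₂ t) x' y') (newSite K A x' y') (marker x y x' y') (d x' y') ⟩
      marker (proj₁ t) (proj₂ t) x' y' + (marker x y x' y' + newSite K A x' y' + d x' y')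
        ≤⟨ +-monoʳ-≤ _ (conservation s x' y') ⟩
      marker (proj₁ t) (proj₂ t) x' y' + inflow ρb d j x' y'
        ≤⟨ marker-absorb (inflow ρb d j) (inflow ρb (bump d x y) j) (proj₁ t) (proj₂ t)
             (inflow-mono ρb (bump-≥ d x y) ≤-refl) feeds x' y' ⟩
      inflow ρb (bump d x y) j x' y'
        ∎
      where open ≤-Reasoning

  stopState : ∀ {K ρb A ρ d j x y} → EpochState K ρb A ρ d j (just (x , y)) → A x y ≡ false →
              EpochState K ρb (insertC x y A) ρ d j nothing
  stopState {K} {ρb} {A} {ρ} {d} {j} {x} {y} s vacant with stopRow s vacant
  ... | refl = record
    { rotorsG      = rotorsG s
    ; rotorS       = rotorS s
    ; withinCap    = withinCap s
    ; walks≤L      = walks≤L s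
    ; rowsBelow    = λ x' y' y'<K → insert-keeps x y A x' y' (rowsBelow s x' y' y'<K)
    ; rowsAbove    = λ x' y' K<y' → trans (insert-otherRow x y A x' y' (λ y'≡K → <-irrefl (sym y'≡K) K<y'))
                                          (rowsAbove s x' y' K<y')
    ; conservation = λ x' y' → ≤-trans (+-monoˡ-≤ (d x' y') (newSite-insert y x y A x' y')) (conservation s x' y')
    ; rowFill      = trans (+-identityʳ _) (trans (insert-rowCount x y A vacant) (trans (+-comm 1 _) (rowFill s)))
    }

  walkState : ∀ {K ρb A ρ d j x y ρ'' x* y*} → EpochState K ρb A ρ d j (just (x , y)) →
              WalkFrom A ρ x y ρ'' x* y* → Σ Departures λ d' → EpochState K ρb (insertC x* y* A) ρ'' d' j nothing
  walkState {d = d} s (stop vacant)     = d , stopState s vacant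
  walkState s         (step occupied w) = walkState (stepState s occupied) w

  launchState : ∀ {K ρb A ρ d j} → EpochState K ρb A ρ d j nothing → j < L →
                EpochState K ρb A (advS ρ) d (suc j) (just (π ⟨$⟩ʳ rS (advS ρ) , 0))
  launchState {K} {ρb} {A} {ρ} {d} {j} s j<L = record
    { rotorsG      = rotorsG s
    ; rotorS       = cong next (rotorS s)
    ; withinCap    = withinCap s
    ; walks≤L      = j<L
    ; rowsBelow    = rowsBelow s
    ; rowsAbove    = rowsAbove s
    ; conservation = λ x' y' → ≤-trans (≤-reflexive (+-assoc (marker x₀ 0 x' y') _ _))
                                 (≤-trans (+-monoʳ-≤ (marker x₀ 0 x' y') (conservation s x' y'))
                                   (marker-absorb (inflow ρb d j) (inflow ρb d (suc j)) x₀ 0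
                                      (inflow-mono ρb (λ _ _ → ≤-refl) (n≤1+n j)) feeds x' y'))
    ; rowFill      = trans (+-comm _ 1) (cong suc (trans (sym (+-identityʳ _)) (rowFill s)))
    }
    where
    x₀ = π ⟨$⟩ʳ rS (advS ρ)
    feeds : inflow ρb d j x₀ 0 < inflow ρb d (suc j) x₀ 0
    feeds = subst (λ i → inflow ρb d j (π ⟨$⟩ʳ i) 0 < inflow ρb d (suc j) (π ⟨$⟩ʳ i) 0)
                  (cong next (sym (rotorS s))) (launch-feeds ρb d j)

  nextEpoch : ∀ {K ρb A ρ d} → EpochState K ρb A ρ d L nothing → EpochState (suc K) ρ A ρ (λ _ _ → 0) 0 nothing
  nextEpoch {K} {ρb} {A} {ρ} {d} s = record
    { rotorsG      = λ _ _ → refl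
    ; rotorS       = refl
    ; withinCap    = λ _ _ → z≤n
    ; walks≤L      = z≤n
    ; rowsBelow    = rowsBelow'
    ; rowsAbove    = λ x y 1+K<y → rowsAbove s x y (<-trans (n<1+n K) 1+K<y)
    ; conservation = λ x y → ≤-trans (≤-reflexive (trans (+-identityʳ _) (newSite-old (suc K) A x y (old x y)))) z≤n
    ; rowFill      = trans (+-identityʳ _) (trans (rowCount-trueCount A (suc K))
                       (trueCount-allFalse _ (λ x → rowsAbove s x (suc K) (n<1+n K))))
    }
    where
    rowK-full : ∀ x → A x K ≡ true
    rowK-full = trueCount-full (λ x → A x K)
                  (trans (sym (rowCount-trueCount A K)) (trans (sym (+-identityʳ _)) (rowFill s)))
    rowsBelow' : ∀ x y → y < suc K → A x y ≡ true
    rowsBelow' x y (s≤s y≤K) with m≤n⇒m<n∨m≡n y≤K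
    ... | inj₁ y<K  = rowsBelow s x y y<K
    ... | inj₂ refl = rowK-full x
    old : ∀ x y → A x y ≡ true → y < suc K
    old x y occupied with y ≤? K
    ... | yes y≤K = s≤s y≤K
    ... | no  y≰K = case trans (sym occupied) (rowsAbove s x y (≰⇒> y≰K)) of λ ()

  initialState : ∀ ρ₀ → EpochState 0 ρ₀ emptyC ρ₀ (λ _ _ → 0) 0 nothing
  initialState ρ₀ = record
    { rotorsG      = λ _ _ → refl
    ; rotorS       = refl
    ; withinCap    = λ _ _ → z≤n
    ; walks≤L      = z≤n
    ; rowsBelow    = λ _ _ ()
    ; rowsAbove    = λ _ _ _ → refl
    ; conservation = λ _ _ → z≤n
    ; rowFill      = trans (+-identityʳ _) (trans (rowCount-trueCount {L} emptyC 0) (trueCount-allFalse {L} _ (λ _ → refl)))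
    }

  -- The unused capacity of rows 0 … K-1; every step of a walk uses up one unit.
  slack : ℕ → Departures → ℕ
  slack K d = sum (map (λ (x , y) → capacity K y ∸ d x y) (cartesianProduct (allFin L) (upTo K)))

  slack-decreases : ∀ K d x y → y < K → suc (d x y) ≤ capacity K y → slack K (bump d x y) < slack K d
  slack-decreases K d x y y<K room =
    sum-map-strict (λ (x' , y') → ∸-monoʳ-≤ (capacity K y') (bump-≥ d x y x' y'))
      (∈-cartesianProduct⁺ (∈-allFin x) (∈-upTo⁺ y<K))
      (subst (λ k → capacity K y ∸ k < capacity K y ∸ d x y) (sym (bump-self d x y))
             (∸-monoʳ-< (n<1+n (d x y)) room))

  -- Every walk terminates: it takes fewer steps than the slack.
  walkExists : ∀ fuel {K ρb A ρ d j x y} → EpochState K ρb A ρ d j (just (x , y)) → slack K d < fuel →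
               Σ (Config L) λ ρ'' → Σ (Fin L) λ x* → Σ ℕ λ y* → WalkFrom A ρ x y ρ'' x* y*
  walkExists (suc fuel) {K} {A = A} {ρ} {d} {x = x} {y} s slack<fuel with A x y in Axy
  ... | false = ρ , x , y , stop Axy
  ... | true with departure-allowed s Axy
  ...   | y<K , room with walkExists fuel (stepState s Axy)
                            (≤-trans (slack-decreases K d x y y<K room) (≤-pred slack<fuel))
  ...     | ρ'' , x* , y* , w = ρ'' , x* , y* , step Axy w

  record Phase (N : ℕ) (A : Cluster L) (ρ : Config L) : Set where
    field
      epoch      : ℕ
      walksDone  : ℕ
      start      : Config L
      departures : Departures
      N≡         : N ≡ epoch * L + walksDone
      walks<L    : walksDone < L
      state      : EpochState epoch start A ρ departures walksDone nothing
  open Phase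

  continuePhase : ∀ {N A ρ K ρb d j} → N ≡ K * L + j → suc j < L →
                  EpochState K ρb A ρ d (suc j) nothing → Phase (suc N) A ρ
  continuePhase {K = K} {ρb} {d} {j} N≡KL+j 1+j<L s = record
    { epoch = K ; walksDone = suc j ; start = ρb ; departures = d
    ; N≡ = trans (cong suc N≡KL+j) (sym (+-suc (K * L) j)) ; walks<L = 1+j<L ; state = s }

  finishPhase : ∀ {N A ρ K ρb d j} → 0 < L → N ≡ K * L + j → suc j ≡ L →
                EpochState K ρb A ρ d (suc j) nothing → Phase (suc N) A ρ
  finishPhase {N} {A} {ρ} {K} {ρb} {d} {j} L>0 N≡KL+j 1+j≡L s = record
    { epoch = suc K ; walksDone = 0 ; start = ρ ; departures = λ _ _ → 0
    ; N≡ = count ; walks<L = L>0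
    ; state = nextEpoch (subst (λ k → EpochState K ρb A ρ d k nothing) 1+j≡L s) }
    where
    open ≡-Reasoning
    count : suc N ≡ suc K * L + 0
    count = begin
      suc N           ≡⟨ cong suc N≡KL+j ⟩
      suc (K * L + j) ≡⟨ +-suc (K * L) j ⟨
      K * L + suc j   ≡⟨ cong (K * L +_) 1+j≡L ⟩
      K * L + L       ≡⟨ +-comm (K * L) L ⟩
      suc K * L       ≡⟨ +-identityʳ (suc K * L) ⟨
      suc K * L + 0   ∎

  aggPhase : ∀ {ρ₀ N A ρ} → 0 < L → Agg π ρ₀ N A ρ → Phase N A ρ
  aggPhase {ρ₀} L>0 agg0 = record
    { epoch = 0 ; walksDone = 0 ; start = ρ₀ ; departures = λ _ _ → 0
    ; N≡ = refl ; walks<L = L>0 ; state = initialState ρ₀ }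
  aggPhase L>0 (aggS ag (fromS w)) with aggPhase L>0 ag
  ... | p with walkState (launchState (state p) (walks<L p)) w | m≤n⇒m<n∨m≡n (walks<L p)
  ...   | _ , s | inj₁ 1+j<L = continuePhase (N≡ p) 1+j<L s
  ...   | _ , s | inj₂ 1+j≡L = finishPhase L>0 (N≡ p) 1+j≡L s

  aggExists : 0 < L → ∀ ρ₀ N → Σ (Cluster L) λ A → Σ (Config L) λ ρ → Agg π ρ₀ N A ρ
  aggExists L>0 ρ₀ zero = emptyC , ρ₀ , agg0
  aggExists L>0 ρ₀ (suc N) with aggExists L>0 ρ₀ N
  ... | A , ρ , ag with aggPhase L>0 ag
  ...   | p with walkExists (suc (slack (epoch p) (departures p))) (launchState (state p) (walks<L p)) ≤-refl
  ...     | ρ'' , x* , y* , w = insertC x* y* A , ρ'' , aggS ag (fromS w)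

  clusterAfter : ∀ {ρ₀} K n → n < L → ∀ A ρ → Agg π ρ₀ (K * L + n) A ρ →
                 (∀ x y → y < K → A x y ≡ true) × (∀ x y → K < y → A x y ≡ false) × rowCount A K ≡ n
  clusterAfter K n n<L A ρ agg with aggPhase (≤-trans (s≤s z≤n) n<L) agg
  ... | p with divMod-unique {K = K} {K' = epoch p} n<L (walks<L p) (N≡ p)
  ...   | refl , refl = rowsBelow (state p) , rowsAbove (state p) , trans (sym (+-identityʳ _)) (rowFill (state p))

mainTheorem1 : (L : ℕ) → 1 ≤ L → (π : Permutation′ L) → (ρ₀ : Config L) →
    ((K : ℕ) →
      (∃[ A ] ∃[ ρ ] Agg π ρ₀ (K * L) A ρ)
      × (∀ A ρ → Agg π ρ₀ (K * L) A ρ → ∀ x y → A x y ≡ rowsC K x y))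
    × ((K n : ℕ) → n < L →
      (∃[ A ] ∃[ ρ ] Agg π ρ₀ (K * L + n) A ρ)
      × (∀ A ρ → Agg π ρ₀ (K * L + n) A ρ →
          (∀ (x : Fin L) y → y < K → A x y ≡ true)
          × (∀ (x : Fin L) y → K < y → A x y ≡ false)
          × rowCount A K ≡ n))
mainTheorem1 L 1≤L π ρ₀ =
    (λ K → aggExists 1≤L ρ₀ (K * L) , completeRows K)
  , (λ K n n<L → aggExists 1≤L ρ₀ (K * L + n) , clusterAfter K n n<L)
  where
  open Aggregation π
  completeRows : ∀ K A ρ → Agg π ρ₀ (K * L) A ρ → ∀ x y → A x y ≡ rowsC K x y
  completeRows K A ρ agg =
    let below , above , rowK = clusterAfter K 0 1≤L A ρ (subst (λ N → Agg π ρ₀ N A ρ) (sym (+-identityʳ (K * L))) agg)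
    in rows-exact A K below above rowK
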